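{- Let $(M,w)$ and $(M',w')$ be pointed models such that $(M,w)$ and $(M',w')$ are collectively $\mathtt{P}$-bisimilar. Then for every formula $\psi$ of the language $\mathcal{L}_{[S,\chi]}$ of partial communication, $(M,w)\Vdash\psi$ if and only if $(M',w')\Vdash\psi$.
   Context: Fix a finite non-empty set of agents $A$ and a non-empty countable set of atoms $\mathtt{P}$. A model is $M=\langle W,R,V\rangle$ with $W$ a non-empty set of worlds, $R=\{R_i\subseteq W\times W\mid i\in A\}$ arbitrary binary relations, and $V:\mathtt{P}\to\mathcal{P}(W)$. For $G\subseteq A$ put $R_G:=\bigcap_{k\in G}R_k$ (with $R_\emptyset:=W\times W$). A pointed model is $(M,w)$ with $w\in W$. The language $\mathcal{L}_D$ is given by $\varphi::=p\mid\lnot\varphi\mid\varphi\land\varphi\mid D_G\varphi$ for $p\in\mathtt{P}$ and $\emptyset\neq G\subseteq A$, with $(M,w)\Vdash p$ iff $w\in V(p)$, Boolean clauses as usual, and $(M,w)\Vdash D_G\varphi$ iff $(M,u)\Vdash\varphi$ for all $u$ with $(w,u)\in R_G$. For a formula $\chi$ and model $M$, $\|\chi\|^M$ is the set of worlds of $M$ where $\chi$ holds, and $\sim^M_\chi:=(\|\chi\|^M\times\|\chi\|^M)\cup(\|\lnot\chi\|^M\times\|\lnot\chi\|^M)$. For $S\subseteq A$, the model $M^{S,\chi}=\langle W,R^{S,\chi},V\rangle$ has $R^{S,\chi}_i:=R_i\cap(R_S\cup\sim^M_\chi)$ (so $R^{\emptyset,\chi}_i=R_i$). The language $\mathcal{L}_{[S,\chi]}$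 is $\bigcup_{n}\mathcal{L}^n$ where $\mathcal{L}^0=\mathcal{L}_D$ and $\mathcal{L}^{n+1}$ extends $\mathcal{L}^n$ (closing under $\lnot,\land,D_G$) with formulas $[S,\chi]\varphi$ for $S\subseteq A$ and $\chi\in\mathcal{L}^n$; semantics: $(M,w)\Vdash[S,\chi]\varphi$ iff $(M^{S,\chi},w)\Vdash\varphi$. A collective $\mathtt{P}$-bisimulation between $M=\langle W,R,V\rangle$ and $M'=\langle W',R',V'\rangle$ is a non-empty $Z\subseteq W\times W'$ such that for every $(u,u')\in Z$: (atoms) for all $p\in\mathtt{P}$, $u\in V(p)$ iff $u'\in V'(p)$; (forth) for every $G\subseteq A$ and $v$ with $(u,v)\in R_G$ there is $v'$ with $(u',v')\in R'_G$ and $(v,v')\in Z$; (back) for every $G\subseteq A$ and $v'$ with $(u',v')\in R'_G$ there is $v$ with $(u,v)\in R_G$ and $(v,v')\in Z$. The pointed models $(M,w),(M',w')$ are collectively $\mathtt{P}$-bisimilar if some such $Z$ contains $(w,w')$. -}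

module Defs where

open import Data.Nat using (ℕ; suc)
open import Data.Fin using (Fin)
open import Data.Fin.Subset using (Subset; _∈_; Nonempty)
open import Data.Product using (Σ; ∃; _×_; _,_)
open import Data.Sum using (_⊎_)
open import Relation.Nullary using (¬_)
open import Function using (Injective)
open import Relation.Binary.PropositionalEquality using (_≡_)

-- Agents: A = Fin (suc n) (finite, non-empty).  Groups G ⊆ A: Subset (suc n).
-- Atoms: a type P that is non-empty and countable (injects into ℕ).

record Atoms : Set₁ where
  field
    P        : Set
    inhabit  : P
    code     : P → ℕ
    code-inj : Injective _≡_ _≡_ code

record Model (n : ℕ) (P : Set) : Set₁ where
  field
    W     : Set
    inW   : W
    R     : Fin (suc n) → W → W → Set
    V     : P → W → Set

RG : ∀ {n P} (M : Model n P) → Subset (suc n) → Model.W M → Model.W M → Set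
RG M G u v = ∀ k → k ∈ G → Model.R M k u v

-- Formulas of L_[S,χ] (the union ⋃ₙ Lⁿ): D_G only for non-empty G.
data Form (n : ℕ) (P : Set) : Set where
  atom : P → Form n P
  ¬'   : Form n P → Form n P
  _∧'_ : Form n P → Form n P → Form n P
  D    : (G : Subset (suc n)) → Nonempty G → Form n P → Form n P
  [_,_]_ : Subset (suc n) → Form n P → Form n P → Form n P

Sim : ∀ {W : Set} → (W → Set) → W → W → Set
Sim X u v = (X u × X v) ⊎ (¬ X u × ¬ X v)

-- M^{S,χ}, given the truth set of χ in M
update : ∀ {n P} (M : Model n P) → Subset (suc n) → (Model.W M → Set) → Model n P
update M S X = record
  { W   = Model.W M
  ; inW = Model.inW M
  ; R   = λ i u v → Model.R M i u v × (RG M S u v ⊎ Sim X u v)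
  ; V   = Model.V M
  }

_,_⊩_ : ∀ {n P} (M : Model n P) → Model.W M → Form n P → Set
M , w ⊩ atom p = Model.V M p w
M , w ⊩ ¬' φ = ¬ (M , w ⊩ φ)
M , w ⊩ (φ ∧' ψ) = (M , w ⊩ φ) × (M , w ⊩ ψ)
M , w ⊩ D G _ φ = ∀ u → RG M G w u → M , u ⊩ φ
M , w ⊩ ([ S , χ ] φ) = update M S (λ u → M , u ⊩ χ) , w ⊩ φ

-- collective P-bisimulation (conditions for every G ⊆ A, including ∅)
record IsCollBisim {n P} (M M' : Model n P) (Z : Model.W M → Model.W M' → Set) : Set where
  field
    nonempty : Σ (Model.W M) λ u → Σ (Model.W M') λ u' → Z u u'
    atoms : ∀ {u u'} → Z u u' → ∀ p → (Model.V M p u → Model.V M' p u') × (Model.V M' p u' → Model.V M p u)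
    forth : ∀ {u u'} → Z u u' → ∀ G v → RG M G u v → Σ (Model.W M') λ v' → RG M' G u' v' × Z v v'
    back  : ∀ {u u'} → Z u u' → ∀ G v' → RG M' G u' v' → Σ (Model.W M) λ v → RG M G u v × Z v v'

CollBisimilar : ∀ {n P} (M M' : Model n P) → Model.W M → Model.W M' → Set₁
CollBisimilar M M' w w' = Σ (Model.W M → Model.W M' → Set) λ Z → IsCollBisim M M' Z × Z w w'

-- Collective bisimilarity is preserved by every partial-communication update [S, χ]
-- as soon as it preserves the truth of χ: for a non-empty group G, a step along the
-- updated relation R^{S,χ}_G is either a step along R_{G ∪ S} or a step along R_G that
-- stays inside one ~χ-class, and collective bisimulations can match both kinds of step.
-- Invariance of all formulas then follows by induction, since χ is a subformula of [S, χ]φ.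
module Submission where

open import Defs
open import Data.Nat using (ℕ; suc)
open import Data.Product using (Σ; _×_; _,_; proj₁; proj₂; swap; map)
open import Data.Sum using (_⊎_; inj₁; inj₂)
open import Data.Empty using (⊥-elim)
open import Data.Fin.Subset using (Subset; _∪_; Nonempty; Empty)
open import Data.Fin.Subset.Properties using (nonempty?; x∈p∪q⁺; x∈p∪q⁻)
open import Function using (_∘_; flip)
open import Relation.Nullary using (yes; no)

private variable
  n : ℕ
  P W W' : Set
  G S : Subset (suc n)
  X : W → Set
  X' : W' → Set
  Z : W → W' → Set

Agree : (W → W' → Set) → (W → Set) → (W' → Set) → Set
Agree Z X X' = ∀ {u u'} → Z u u' → (X u → X' u') × (X' u' → X u)

Sim-transport : Agree Z X X' → ∀ {u u' v v'} → Z u u' → Z v v' → Sim X u v → Sim X' u' v'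
Sim-transport agree zu zv (inj₁ (xu , xv)) = inj₁ (proj₁ (agree zu) xu , proj₁ (agree zv) xv)
Sim-transport agree zu zv (inj₂ (¬xu , ¬xv)) = inj₂ (¬xu ∘ proj₂ (agree zu) , ¬xv ∘ proj₂ (agree zv))

module _ (M : Model n P) {u v : Model.W M} where

  RG-empty : Empty G → RG M G u v
  RG-empty ¬ne k k∈G = ⊥-elim (¬ne (k , k∈G))

  RG-∪⁻ : RG M (G ∪ S) u v → RG M G u v × RG M S u v
  RG-∪⁻ r = (λ k k∈G → r k (x∈p∪q⁺ (inj₁ k∈G))) , (λ k k∈S → r k (x∈p∪q⁺ (inj₂ k∈S)))

  RG-∪⁺ : RG M G u v → RG M S u v → RG M (G ∪ S) u v
  RG-∪⁺ {G} {S} rG rS k k∈G∪S with x∈p∪q⁻ G S k∈G∪S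
  ... | inj₁ k∈G = rG k k∈G
  ... | inj₂ k∈S = rS k k∈S

  RG-update-∪ : RG M (G ∪ S) u v → RG (update M S X) G u v
  RG-update-∪ r k k∈G = let rG , rS = RG-∪⁻ r in rG k k∈G , inj₁ rS

  RG-update-Sim : RG M G u v → Sim X u v → RG (update M S X) G u v
  RG-update-Sim rG sim k k∈G = rG k k∈G , inj₂ sim

  -- The disjunct R_S ∪ ~χ does not depend on the agent, so one member of G decides it.
  RG-update⁻ : Nonempty G → RG (update M S X) G u v
    → RG M (G ∪ S) u v ⊎ (RG M G u v × Sim X u v)
  RG-update⁻ (k , k∈G) r with proj₂ (r k k∈G)
  ... | inj₁ rS = inj₁ (RG-∪⁺ (λ j j∈G → proj₁ (r j j∈G)) rS)
  ... | inj₂ sim = inj₂ ((λ j j∈G → proj₁ (r j j∈G)) , sim)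

module _ {M M' : Model n P} where
  open IsCollBisim

  IsCollBisim-flip : {Z : Model.W M → Model.W M' → Set}
    → IsCollBisim M M' Z → IsCollBisim M' M (flip Z)
  nonempty (IsCollBisim-flip B) = let u , u' , z = nonempty B in u' , u , z
  atoms (IsCollBisim-flip B) z p = swap (atoms B z p)
  forth (IsCollBisim-flip B) = back B
  back (IsCollBisim-flip B) = forth B

  update-forth : {S : Subset (suc n)} {Z : Model.W M → Model.W M' → Set}
    {X : Model.W M → Set} {X' : Model.W M' → Set}
    → IsCollBisim M M' Z → Agree Z X X' → ∀ {u u'} → Z u u'
    → ∀ G v → RG (update M S X) G u v → Σ (Model.W M') λ v' → RG (update M' S X') G u' v' × Z v v'
  update-forth {S = S} {X = X} {X' = X'} B agree z G v r with nonempty? G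
  ... | no ¬ne =
    let v' , _ , zv = forth B z G v (RG-empty M ¬ne)
    in v' , RG-empty (update M' S X') ¬ne , zv
  ... | yes ne with RG-update⁻ M ne r
  ...   | inj₁ r∪ =
    let v' , r' , zv = forth B z (G ∪ S) v r∪
    in v' , RG-update-∪ M' {X = X'} r' , zv
  ...   | inj₂ (rG , sim) =
    let v' , r' , zv = forth B z G v rG
    in v' , RG-update-Sim M' {X = X'} {S = S} r' (Sim-transport {X = X} {X' = X'} agree z zv sim) , zv

IsCollBisim-update : {M M' : Model n P} {Z : Model.W M → Model.W M' → Set}
  {X : Model.W M → Set} {X' : Model.W M' → Set} (S : Subset (suc n))
  → IsCollBisim M M' Z → Agree Z X X' → IsCollBisim (update M S X) (update M' S X') Z
IsCollBisim-update S B agree = record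
  { nonempty = IsCollBisim.nonempty B
  ; atoms    = IsCollBisim.atoms B
  ; forth    = update-forth B agree
  ; back     = update-forth (IsCollBisim-flip B) (swap ∘ agree)
  }

⊩-invariant : {M M' : Model n P} {Z : Model.W M → Model.W M' → Set}
  → IsCollBisim M M' Z → (ψ : Form n P) → Agree Z (M ,_⊩ ψ) (M' ,_⊩ ψ)
⊩-invariant B (atom p) z = IsCollBisim.atoms B z p
⊩-invariant B (¬' ψ) z = let to , from = ⊩-invariant B ψ z in (_∘ from) , (_∘ to)
⊩-invariant B (ψ ∧' φ) z =
  let toψ , fromψ = ⊩-invariant B ψ z
      toφ , fromφ = ⊩-invariant B φ z
  in map toψ toφ , map fromψ fromφ
⊩-invariant B (D G _ ψ) z =
    (λ h v' r' → let v , r , zv = IsCollBisim.back B z G v' r' in proj₁ (⊩-invariant B ψ zv) (h v r))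
  , (λ h v r → let v' , r' , zv = IsCollBisim.forth B z G v r in proj₂ (⊩-invariant B ψ zv) (h v' r'))
⊩-invariant B ([ S , χ ] φ) z = ⊩-invariant (IsCollBisim-update S B (⊩-invariant B χ)) φ z

theorem2p11 : (n : ℕ) (𝒫 : Atoms) (M M' : Model n (Atoms.P 𝒫)) (w : Model.W M) (w' : Model.W M')
    → CollBisimilar M M' w w'
    → (ψ : Form n (Atoms.P 𝒫)) → ((M , w ⊩ ψ) → (M' , w' ⊩ ψ)) × ((M' , w' ⊩ ψ) → (M , w ⊩ ψ))
theorem2p11 n 𝒫 M M' w w' (Z , B , z) ψ = ⊩-invariant B ψ z
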